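{- Let $\mathcal{D}^h$ be a high-level BAT, $\mathcal{D}^l$ a low-level BAT, $m$ a refinement mapping between them, and suppose $M_h\models\mathcal{D}^h$ and $M_l\models\mathcal{D}^l\cup\mathcal{C}$. If (a) $S_0^{M_h}\simeq_m^{M_h,M_l}S_0^{M_l}$, (b) $M_l\models\forall s.\,Do(\textsc{anyseqhl},S_0,s)\supset\bigwedge_{A_i\in\mathcal{A}^h}\forall\vec x.\,\big(m(\phi^{Poss}_{A_i}(\vec x))[s]\equiv\exists s'.\,Do(m(A_i(\vec x)),s,s')\big)$, and (c) $M_l\models\forall s.\,Do(\textsc{anyseqhl},S_0,s)\supset\bigwedge_{A_i\in\mathcal{A}^h}\forall\vec x,s'.\,\Big(Do(m(A_i(\vec x)),s,s')\supset\bigwedge_{F_i\in\mathcal{F}^h}\forall\vec y\,\big(m(\phi^{ssa}_{F_i,A_i}(\vec y,\vec x))[s]\equiv m(F_i(\vec y))[s']\big)\Big)$, then $M_h\sim_m M_l$. Here $\phi^{Poss}_{A_i}(\vec x)$ is the (situation-suppressed) right-hand side of the precondition axiom of $A_i(\vec x)$ in $\mathcal{D}^h$, and $\phi^{ssa}_{F_i,A_i}(\vec y,\vec x)$ is the (situation-suppressed) right-hand side of the successor state axiom of $F_i$ in $\mathcal{D}^h$ instantiated with action $A_i(\vec x)$, with action terms eliminated using $\mathcal{D}^h_{ca}$.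
   Context: Situation calculus setting. Objects are a countably infinite set $\mathcal{N}$ of standard names (unique names and domain closure); no function symbols other than constants; no non-fluent predicates. Situations: $S_0$ and $do(a,s)$. $Poss(a,s)$ means $a$ is executable in $s$. A basic action theory (BAT) over finitely many action types $\mathcal{A}$ and fluents $\mathcal{F}$ is the union of: initial-state axioms $\mathcal{D}_{S_0}$; precondition axioms $Poss(A(\vec x),s)\equiv\phi^{Poss}_A(\vec x,s)$; successor state axioms $F(\vec x,do(a,s))\equiv\phi^{ssa}_F(\vec x,a,s)$ (right-hand sides uniform in $s$); $\mathcal{D}_{ca}$, unique names axioms for actions and domain closure on action types; $\mathcal{D}_{coa}$, unique names and domain closure for objects; and the foundational axioms $\Sigma$. A situation-suppressed formula omits situation arguments of fluents; $\phi[s]$ restores $s$. ConGolog programs $\delta::=\alpha\mid\varphi?\mid\delta_1;\delta_2\mid\delta_1|\delta_2\mid\pi x.\delta\mid\delta^*\mid\delta_1\|\delta_2$, $nil=True?$; $\mathcal{C}$ are the axioms: $Trans(\alpha,s,\delta',s')\equiv s'=do(\alpha,s)\land Poss(\alpha,s)\land\delta'=True?$; $Trans(\varphi?,s,\delta',s')\equiv False$; $Trans(\delta_1;\delta_2,s,\delta',s')\equiv\exists\delta_1'(Trans(\delta_1,s,\delta_1',s')\land\delta'=\delta_1';\delta_2)\lor(Final(\delta_1,s)\land Trans(\delta_2,s,\delta',s'))$; $Trans(\delta_1|\delta_2,\cdot)\equiv Trans(\delta_1,\cdot)\lor Trans(\delta_2,\cdot)$; $Trans(\pi x.\delta,s,\delta',s')\equiv\exists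 x.Trans(\delta,s,\delta',s')$; $Trans(\delta^*,s,\delta',s')\equiv\exists\delta''(Trans(\delta,s,\delta'',s')\land\delta'=\delta'';\delta^*)$; $Trans(\delta_1\|\delta_2,s,\delta',s')\equiv\exists\delta_1'(Trans(\delta_1,s,\delta_1',s')\land\delta'=\delta_1'\|\delta_2)\lor\exists\delta_2'(Trans(\delta_2,s,\delta_2',s')\land\delta'=\delta_1\|\delta_2')$; $Final(\alpha,s)\equiv False$; $Final(\varphi?,s)\equiv\varphi[s]$; $Final(\delta_1;\delta_2,s)\equiv Final(\delta_1,s)\land Final(\delta_2,s)$; $Final(\delta_1|\delta_2,s)\equiv Final(\delta_1,s)\lor Final(\delta_2,s)$; $Final(\pi x.\delta,s)\equiv\exists x.Final(\delta,s)$; $Final(\delta^*,s)\equiv True$; $Final(\delta_1\|\delta_2,s)\equiv Final(\delta_1,s)\land Final(\delta_2,s)$. $Do(\delta,s,s')\doteq\exists\delta'.Trans^*(\delta,s,\delta',s')\land Final(\delta',s')$, $Trans^*$ the reflexive transitive closure. $\mathcal{D}^h$ and $\mathcal{D}^l$ have action types $\mathcal{A}^h,\mathcal{A}^l$ and fluents $\mathcal{F}^h,\mathcal{F}^l$, sharing only $\mathcal{N}$. A refinement mapping $m$ maps each $A\in\mathcal{A}^h$ to a situation-determined ConGolog program $m(A(\vec x))$ over $\mathcal{D}^l$ with free variables $\vec x$, and each $F\in\mathcal{F}^h$ to a situation-suppressed low-level formula $m(F(\vec x))$ with free variables $\vec x$; $m(\phi)$ substitutes $m(F(\vec x))$ for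 fluent atoms. For a model $M_h$ of $\mathcal{D}^h$ and a model $M_l$ of $\mathcal{D}^l\cup\mathcal{C}$: $s_h\simeq_m^{M_h,M_l}s_l$ iff for all $F\in\mathcal{F}^h$ and assignments $v$, $M_h,v[s/s_h]\models F(\vec x,s)$ iff $M_l,v[s/s_l]\models m(F(\vec x))[s]$. A relation $B$ between situation domains is an $m$-bisimulation if each $\langle s_h,s_l\rangle\in B$ satisfies: (1) $s_h\simeq_m^{M_h,M_l}s_l$; (2) for each $A\in\mathcal{A}^h$ and $v$, if some $s_h'$ has $M_h,v[s/s_h,s'/s_h']\models Poss(A(\vec x),s)\land s'=do(A(\vec x),s)$ then some $s_l'$ has $M_l,v[s/s_l,s'/s_l']\models Do(m(A(\vec x)),s,s')$ and $\langle s_h',s_l'\rangle\in B$; (3) conversely, if some $s_l'$ has $M_l,v[s/s_l,s'/s_l']\models Do(m(A(\vec x)),s,s')$ then some $s_h'$ has $M_h,v[s/s_h,s'/s_h']\models Poss(A(\vec x),s)\land s'=do(A(\vec x),s)$ and $\langle s_h',s_l'\rangle\in B$. $M_h\sim_m M_l$ iff some $m$-bisimulation contains $\langle S_0^{M_h},S_0^{M_l}\rangle$. $\textsc{any1hl}\doteq|_{A_i\in\mathcal{A}^h}\pi\vec x.\,m(A_i(\vec x))$ and $\textsc{anyseqhl}\doteq\textsc{any1hl}^*$. -}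

module Defs where

open import Data.Nat using (ℕ; zero; suc; _+_)
open import Data.Fin using (Fin; zero; suc)
open import Data.Vec using (Vec; []; _∷_; lookup; _++_)
import Data.Vec as V
open import Data.List using (List; []; _∷_)
open import Data.Product using (Σ; _×_; _,_)
open import Data.Sum using (_⊎_)
open import Data.Unit using (⊤)
open import Data.Empty using (⊥)
open import Relation.Nullary using (¬_)
open import Relation.Binary.PropositionalEquality using (_≡_)
open import Function.Bundles using (_⇔_)

-- Signatures: finitely many action types and fluents, with arities.
-- Objects are the standard names ℕ (unique names + domain closure).

record Sig : Set where
  field
    nA  : ℕ
    arA : Fin nA → ℕ
    nF  : ℕ
    arF : Fin nF → ℕ
open Sig public

data Term (n : ℕ) : Set where
  var : Fin n → Term n
  nm  : ℕ → Term n

evalT : ∀ {n} → Term n → Vec ℕ n → ℕ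
evalT (var i) v = lookup v i
evalT (nm c)  v = c

-- Situation-suppressed first-order formulas over the fluents of S,
-- with n free object variables (well-scoped de Bruijn syntax).
data Fml (S : Sig) (n : ℕ) : Set where
  ⊤ᶠ ⊥ᶠ  : Fml S n
  _≐_     : Term n → Term n → Fml S n
  flu     : (F : Fin (nF S)) → Vec (Term n) (arF S F) → Fml S n
  ¬ᶠ      : Fml S n → Fml S n
  _∧ᶠ_ _∨ᶠ_ _⇒ᶠ_ : Fml S n → Fml S n → Fml S n
  ∃ᶠ ∀ᶠ   : Fml S (suc n) → Fml S n

wkT : ∀ {n} → Term n → Term (suc n)
wkT (var i) = var (suc i)
wkT (nm c)  = nm c

substT : ∀ {k n} → (Fin k → Term n) → Term k → Term n
substT σ (var i) = σ i
substT σ (nm c)  = nm c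

liftσ : ∀ {k n} → (Fin k → Term n) → Fin (suc k) → Term (suc n)
liftσ σ zero    = var zero
liftσ σ (suc i) = wkT (σ i)

substF : ∀ {S k n} → Fml S k → (Fin k → Term n) → Fml S n
substF ⊤ᶠ σ = ⊤ᶠ
substF ⊥ᶠ σ = ⊥ᶠ
substF (t ≐ u) σ = substT σ t ≐ substT σ u
substF (flu F ts) σ = flu F (V.map (substT σ) ts)
substF (¬ᶠ φ) σ = ¬ᶠ (substF φ σ)
substF (φ ∧ᶠ ψ) σ = substF φ σ ∧ᶠ substF ψ σ
substF (φ ∨ᶠ ψ) σ = substF φ σ ∨ᶠ substF ψ σ
substF (φ ⇒ᶠ ψ) σ = substF φ σ ⇒ᶠ substF ψ σ
substF (∃ᶠ φ) σ = ∃ᶠ (substF φ (liftσ σ))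
substF (∀ᶠ φ) σ = ∀ᶠ (substF φ (liftσ σ))

-- In every model of Σ ∪ D_ca ∪ D_coa
-- (standard names) the situation domain is (isomorphic to) the tree of
-- finite sequences of ground actions, generated freely by S₀ and doₛ.

GAct : Sig → Set
GAct S = Σ (Fin (nA S)) (λ A → Vec ℕ (arA S A))

data Sit (S : Sig) : Set where
  S₀  : Sit S
  doₛ : GAct S → Sit S → Sit S

record Struct (S : Sig) : Set₁ where
  field
    Flu  : (F : Fin (nF S)) → Vec ℕ (arF S F) → Sit S → Set
    Poss : GAct S → Sit S → Set
open Struct public

Holds : ∀ {S n} → Struct S → Fml S n → Vec ℕ n → Sit S → Set
Holds M ⊤ᶠ v s = ⊤
Holds M ⊥ᶠ v s = ⊥
Holds M (t ≐ u) v s = evalT t v ≡ evalT u v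
Holds M (flu F ts) v s = Flu M F (V.map (λ t → evalT t v) ts) s
Holds M (¬ᶠ φ) v s = ¬ Holds M φ v s
Holds M (φ ∧ᶠ ψ) v s = Holds M φ v s × Holds M ψ v s
Holds M (φ ∨ᶠ ψ) v s = Holds M φ v s ⊎ Holds M ψ v s
Holds M (φ ⇒ᶠ ψ) v s = Holds M φ v s → Holds M ψ v s
Holds M (∃ᶠ φ) v s = Σ ℕ (λ d → Holds M φ (d ∷ v) s)
Holds M (∀ᶠ φ) v s = (d : ℕ) → Holds M φ (d ∷ v) s

-- D0        : the initial-state axioms (a set of sentences about S0)
--  φPoss A   : RHS of Poss(A(x⃗),s) ≡ φPoss_A(x⃗,s), free vars x⃗
--  φssa F A  : RHS of the SSA of F instantiated with action A(x⃗)
--              (action terms eliminated with D_ca), free vars y⃗ ++ x⃗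

record BAT (S : Sig) : Set₁ where
  field
    D0    : Fml S 0 → Set
    φPoss : (A : Fin (nA S)) → Fml S (arA S A)
    φssa  : (F : Fin (nF S)) (A : Fin (nA S)) → Fml S (arF S F + arA S A)
open BAT public

IsModel : ∀ {S} → BAT S → Struct S → Set
IsModel {S} D M =
    (∀ φ → D0 D φ → Holds M φ [] S₀)
  × (∀ (A : Fin (nA S)) (x : Vec ℕ (arA S A)) (s : Sit S) →
       Poss M (A , x) s ⇔ Holds M (φPoss D A) x s)
  × (∀ (F : Fin (nF S)) (A : Fin (nA S)) (y : Vec ℕ (arF S F))
       (x : Vec ℕ (arA S A)) (s : Sit S) →
       Flu M F y (doₛ (A , x) s) ⇔ Holds M (φssa D F A) (y ++ x) s)

data Prog (S : Sig) (n : ℕ) : Set where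
  act    : (A : Fin (nA S)) → Vec (Term n) (arA S A) → Prog S n
  _¿     : Fml S n → Prog S n
  _⨾_    : Prog S n → Prog S n → Prog S n
  _∣_    : Prog S n → Prog S n → Prog S n
  pick   : Prog S (suc n) → Prog S n
  star   : Prog S n → Prog S n
  _∥_    : Prog S n → Prog S n → Prog S n

nil : ∀ {S n} → Prog S n
nil = ⊤ᶠ ¿

substP : ∀ {S k n} → Prog S k → (Fin k → Term n) → Prog S n
substP (act A ts) σ = act A (V.map (substT σ) ts)
substP (φ ¿) σ = substF φ σ ¿
substP (δ ⨾ γ) σ = substP δ σ ⨾ substP γ σ
substP (δ ∣ γ) σ = substP δ σ ∣ substP γ σ
substP (pick δ) σ = pick (substP δ (liftσ σ))
substP (star δ) σ = star (substP δ σ)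
substP (δ ∥ γ) σ = substP δ σ ∥ substP γ σ

inst : ∀ {S} → Prog S 1 → ℕ → Prog S 0
inst δ d = substP δ (λ _ → nm d)

close : ∀ {S k} → Prog S k → Vec ℕ k → Prog S 0
close δ x = substP δ (λ i → nm (lookup x i))

-- ConGolog transition semantics C in a structure (standard model of the
-- program sort; Trans, Final given by the axioms of C, Trans* the
-- reflexive transitive closure).
data Final {S} (M : Struct S) : Prog S 0 → Sit S → Set where
  f-test  : ∀ {φ s} → Holds M φ [] s → Final M (φ ¿) s
  f-seq   : ∀ {δ γ s} → Final M δ s → Final M γ s → Final M (δ ⨾ γ) s
  f-ch₁   : ∀ {δ γ s} → Final M δ s → Final M (δ ∣ γ) s
  f-ch₂   : ∀ {δ γ s} → Final M γ s → Final M (δ ∣ γ) s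
  f-pick  : ∀ {δ s} (d : ℕ) → Final M (inst δ d) s → Final M (pick δ) s
  f-star  : ∀ {δ s} → Final M (star δ) s
  f-conc  : ∀ {δ γ s} → Final M δ s → Final M γ s → Final M (δ ∥ γ) s

data Trans {S} (M : Struct S) : Prog S 0 → Sit S → Prog S 0 → Sit S → Set where
  t-act   : ∀ {A ts s} → Poss M (A , V.map (λ t → evalT t []) ts) s →
            Trans M (act A ts) s nil (doₛ (A , V.map (λ t → evalT t []) ts) s)
  t-seq₁  : ∀ {δ δ' γ s s'} → Trans M δ s δ' s' → Trans M (δ ⨾ γ) s (δ' ⨾ γ) s'
  t-seq₂  : ∀ {δ γ γ' s s'} → Final M δ s → Trans M γ s γ' s' → Trans M (δ ⨾ γ) s γ' s'
  t-ch₁   : ∀ {δ γ δ' s s'} → Trans M δ s δ' s' → Trans M (δ ∣ γ) s δ' s'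
  t-ch₂   : ∀ {δ γ γ' s s'} → Trans M γ s γ' s' → Trans M (δ ∣ γ) s γ' s'
  t-pick  : ∀ {δ δ' s s'} (d : ℕ) → Trans M (inst δ d) s δ' s' → Trans M (pick δ) s δ' s'
  t-star  : ∀ {δ δ' s s'} → Trans M δ s δ' s' → Trans M (star δ) s (δ' ⨾ star δ) s'
  t-conc₁ : ∀ {δ δ' γ s s'} → Trans M δ s δ' s' → Trans M (δ ∥ γ) s (δ' ∥ γ) s'
  t-conc₂ : ∀ {δ γ γ' s s'} → Trans M γ s γ' s' → Trans M (δ ∥ γ) s (δ ∥ γ') s'

data Trans* {S} (M : Struct S) : Prog S 0 → Sit S → Prog S 0 → Sit S → Set where
  ε   : ∀ {δ s} → Trans* M δ s δ s
  _◅_ : ∀ {δ s δ' s' δ'' s''} → Trans M δ s δ' s' → Trans* M δ' s' δ'' s'' →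
        Trans* M δ s δ'' s''

Do : ∀ {S} → Struct S → Prog S 0 → Sit S → Sit S → Set
Do M δ s s' = Σ (Prog _ 0) (λ δ' → Trans* M δ s δ' s' × Final M δ' s')

record Refinement {Sh Sl : Sig} (Dh : BAT Sh) (Dl : BAT Sl) : Set₁ where
  field
    mA : (A : Fin (nA Sh)) → Prog Sl (arA Sh A)
    mF : (F : Fin (nF Sh)) → Fml Sl (arF Sh F)
    -- each m(A(x⃗)) is situation-determined: Dl ∪ C ⊨ SD(m(A(x⃗)))
    sd : ∀ (M : Struct Sl) → IsModel Dl M →
         ∀ A (x : Vec ℕ (arA Sh A)) (s s' : Sit Sl) (δ₁ δ₂ : Prog Sl 0) →
         Trans* M (close (mA A) x) s δ₁ s' →
         Trans* M (close (mA A) x) s δ₂ s' → δ₁ ≡ δ₂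
open Refinement public

mapF : ∀ {Sh Sl} {Dh : BAT Sh} {Dl : BAT Sl} → Refinement Dh Dl →
       ∀ {n} → Fml Sh n → Fml Sl n
mapF m ⊤ᶠ = ⊤ᶠ
mapF m ⊥ᶠ = ⊥ᶠ
mapF m (t ≐ u) = t ≐ u
mapF m (flu F ts) = substF (mF m F) (lookup ts)
mapF m (¬ᶠ φ) = ¬ᶠ (mapF m φ)
mapF m (φ ∧ᶠ ψ) = mapF m φ ∧ᶠ mapF m ψ
mapF m (φ ∨ᶠ ψ) = mapF m φ ∨ᶠ mapF m ψ
mapF m (φ ⇒ᶠ ψ) = mapF m φ ⇒ᶠ mapF m ψ
mapF m (∃ᶠ φ) = ∃ᶠ (mapF m φ)
mapF m (∀ᶠ φ) = ∀ᶠ (mapF m φ)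

piAll : ∀ {S} k → Prog S k → Prog S 0
piAll zero δ = δ
piAll (suc k) δ = piAll k (pick δ)

choiceFin : ∀ {S} n → (Fin n → Prog S 0) → Prog S 0
choiceFin zero f = ⊥ᶠ ¿
choiceFin (suc zero) f = f zero
choiceFin (suc (suc n)) f = f zero ∣ choiceFin (suc n) (λ i → f (suc i))

any1hl : ∀ {Sh Sl} {Dh : BAT Sh} {Dl : BAT Sl} → Refinement Dh Dl → Prog Sl 0
any1hl {Sh} m = choiceFin (nA Sh) (λ A → piAll (arA Sh A) (mA m A))

anyseqhl : ∀ {Sh Sl} {Dh : BAT Sh} {Dl : BAT Sl} → Refinement Dh Dl → Prog Sl 0
anyseqhl m = star (any1hl m)

module _ {Sh Sl : Sig} {Dh : BAT Sh} {Dl : BAT Sl} (m : Refinement Dh Dl)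
         (Mh : Struct Sh) (Ml : Struct Sl) where

  MIso : Sit Sh → Sit Sl → Set
  MIso sh sl = ∀ (F : Fin (nF Sh)) (y : Vec ℕ (arF Sh F)) →
               Flu Mh F y sh ⇔ Holds Ml (mF m F) y sl

  IsBisim : (Sit Sh → Sit Sl → Set) → Set
  IsBisim B = ∀ sh sl → B sh sl →
      MIso sh sl
    × (∀ (A : Fin (nA Sh)) (x : Vec ℕ (arA Sh A)) (sh' : Sit Sh) →
         Poss Mh (A , x) sh → sh' ≡ doₛ (A , x) sh →
         Σ (Sit Sl) (λ sl' → Do Ml (close (mA m A) x) sl sl' × B sh' sl'))
    × (∀ (A : Fin (nA Sh)) (x : Vec ℕ (arA Sh A)) (sl' : Sit Sl) →
         Do Ml (close (mA m A) x) sl sl' →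
         Σ (Sit Sh) (λ sh' → (Poss Mh (A , x) sh × sh' ≡ doₛ (A , x) sh) × B sh' sl'))

  Bisimilar : Set₁
  Bisimilar = Σ (Sit Sh → Sit Sl → Set) (λ B → IsBisim B × B S₀ S₀)

{-# OPTIONS --safe #-}
module Submission where

-- The bisimulation pairs m-isomorphic situations whose low-level member is reachable by
-- anyseqhl.  On such a pair, (b) and the precondition axioms of Dh make A(x⃗) possible exactly
-- when m(A(x⃗)) has a terminating run, and (c) with the successor state axioms of Dh carries
-- the m-isomorphism across every such run; it remains to see that such a run ends in a
-- reachable situation again.

open import Defs
open import Data.Nat using (ℕ; zero; suc)
open import Data.Fin using (Fin; zero; suc)
open import Data.Vec using (Vec; []; _∷_; _++_; lookup)
import Data.Vec as V
open import Data.Vec.Properties using (map-∘; map-cong; map-id; lookup-map)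
open import Data.Product using (Σ; _×_; _,_; proj₁; proj₂)
open import Data.Product.Function.NonDependent.Propositional using (_×-⇔_)
open import Data.Product.Function.Dependent.Propositional using () renaming (congˡ to Σ-congˡ)
open import Data.Sum.Function.Propositional using (_⊎-⇔_)
open import Function.Bundles using (_⇔_; mk⇔; Equivalence)
open import Function.Related.Propositional
  using (K-refl; K-reflexive; K-trans; SK-sym; module EquationalReasoning)
open import Function.Related.TypeIsomorphisms using (→-cong-⇔; ¬-cong-⇔)
open import Relation.Binary.PropositionalEquality
  using (_≡_; refl; sym; trans; cong; cong₂)

open Equivalence using (to; from)

substT-wkT : ∀ {k n} (τ : Fin k → Term n) (t : Term k) →
             substT (liftσ τ) (wkT t) ≡ wkT (substT τ t)
substT-wkT τ (var i) = refl
substT-wkT τ (nm c)  = refl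

module _ {k n p} {σ : Fin k → Term n} {τ : Fin n → Term p} {ρ : Fin k → Term p}
         (σ⨟τ≗ρ : ∀ i → substT τ (σ i) ≡ ρ i) where

  substT-∘ : ∀ t → substT τ (substT σ t) ≡ substT ρ t
  substT-∘ (var i) = σ⨟τ≗ρ i
  substT-∘ (nm c)  = refl

  map-substT-∘ : ∀ {m} (ts : Vec (Term k) m) →
                 V.map (substT τ) (V.map (substT σ) ts) ≡ V.map (substT ρ) ts
  map-substT-∘ ts = trans (sym (map-∘ (substT τ) (substT σ) ts)) (map-cong substT-∘ ts)

  liftσ-∘ : ∀ i → substT (liftσ τ) (liftσ σ i) ≡ liftσ ρ i
  liftσ-∘ zero    = refl
  liftσ-∘ (suc i) = trans (substT-wkT τ (σ i)) (cong wkT (σ⨟τ≗ρ i))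

substF-∘ : ∀ {S k n p} (φ : Fml S k) {σ : Fin k → Term n} {τ : Fin n → Term p}
           {ρ : Fin k → Term p} → (∀ i → substT τ (σ i) ≡ ρ i) →
           substF (substF φ σ) τ ≡ substF φ ρ
substF-∘ ⊤ᶠ         e = refl
substF-∘ ⊥ᶠ         e = refl
substF-∘ (t ≐ u)    e = cong₂ _≐_ (substT-∘ e t) (substT-∘ e u)
substF-∘ (flu F ts) e = cong (flu F) (map-substT-∘ e ts)
substF-∘ (¬ᶠ φ)     e = cong ¬ᶠ (substF-∘ φ e)
substF-∘ (φ ∧ᶠ ψ)   e = cong₂ _∧ᶠ_ (substF-∘ φ e) (substF-∘ ψ e)
substF-∘ (φ ∨ᶠ ψ)   e = cong₂ _∨ᶠ_ (substF-∘ φ e) (substF-∘ ψ e)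
substF-∘ (φ ⇒ᶠ ψ)   e = cong₂ _⇒ᶠ_ (substF-∘ φ e) (substF-∘ ψ e)
substF-∘ (∃ᶠ φ)     e = cong ∃ᶠ (substF-∘ φ (liftσ-∘ e))
substF-∘ (∀ᶠ φ)     e = cong ∀ᶠ (substF-∘ φ (liftσ-∘ e))

substP-∘ : ∀ {S k n p} (δ : Prog S k) {σ : Fin k → Term n} {τ : Fin n → Term p}
           {ρ : Fin k → Term p} → (∀ i → substT τ (σ i) ≡ ρ i) →
           substP (substP δ σ) τ ≡ substP δ ρ
substP-∘ (act A ts) e = cong (act A) (map-substT-∘ e ts)
substP-∘ (φ ¿)      e = cong _¿ (substF-∘ φ e)
substP-∘ (δ ⨾ γ)    e = cong₂ _⨾_ (substP-∘ δ e) (substP-∘ γ e)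
substP-∘ (δ ∣ γ)    e = cong₂ _∣_ (substP-∘ δ e) (substP-∘ γ e)
substP-∘ (pick δ)   e = cong pick (substP-∘ δ (liftσ-∘ e))
substP-∘ (star δ)   e = cong star (substP-∘ δ e)
substP-∘ (δ ∥ γ)    e = cong₂ _∥_ (substP-∘ δ e) (substP-∘ γ e)

module _ {k} {σ : Fin k → Term k} (σ≗var : ∀ i → σ i ≡ var i) where

  substT-id : ∀ t → substT σ t ≡ t
  substT-id (var i) = σ≗var i
  substT-id (nm c)  = refl

  map-substT-id : ∀ {m} (ts : Vec (Term k) m) → V.map (substT σ) ts ≡ ts
  map-substT-id ts = trans (map-cong substT-id ts) (map-id ts)

  liftσ-id : ∀ i → liftσ σ i ≡ var i
  liftσ-id zero    = refl
  liftσ-id (suc i) = cong wkT (σ≗var i)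

substF-id : ∀ {S k} (φ : Fml S k) {σ : Fin k → Term k} →
            (∀ i → σ i ≡ var i) → substF φ σ ≡ φ
substF-id ⊤ᶠ         e = refl
substF-id ⊥ᶠ         e = refl
substF-id (t ≐ u)    e = cong₂ _≐_ (substT-id e t) (substT-id e u)
substF-id (flu F ts) e = cong (flu F) (map-substT-id e ts)
substF-id (¬ᶠ φ)     e = cong ¬ᶠ (substF-id φ e)
substF-id (φ ∧ᶠ ψ)   e = cong₂ _∧ᶠ_ (substF-id φ e) (substF-id ψ e)
substF-id (φ ∨ᶠ ψ)   e = cong₂ _∨ᶠ_ (substF-id φ e) (substF-id ψ e)
substF-id (φ ⇒ᶠ ψ)   e = cong₂ _⇒ᶠ_ (substF-id φ e) (substF-id ψ e)
substF-id (∃ᶠ φ)     e = cong ∃ᶠ (substF-id φ (liftσ-id e))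
substF-id (∀ᶠ φ)     e = cong ∀ᶠ (substF-id φ (liftσ-id e))

substP-id : ∀ {S k} (δ : Prog S k) {σ : Fin k → Term k} →
            (∀ i → σ i ≡ var i) → substP δ σ ≡ δ
substP-id (act A ts) e = cong (act A) (map-substT-id e ts)
substP-id (φ ¿)      e = cong _¿ (substF-id φ e)
substP-id (δ ⨾ γ)    e = cong₂ _⨾_ (substP-id δ e) (substP-id γ e)
substP-id (δ ∣ γ)    e = cong₂ _∣_ (substP-id δ e) (substP-id γ e)
substP-id (pick δ)   e = cong pick (substP-id δ (liftσ-id e))
substP-id (star δ)   e = cong star (substP-id δ e)
substP-id (δ ∥ γ)    e = cong₂ _∥_ (substP-id δ e) (substP-id γ e)

close-[] : ∀ {S} (δ : Prog S 0) → close δ [] ≡ δ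
close-[] δ = substP-id δ (λ ())

close-∷ : ∀ {S k} (δ : Prog S (suc k)) d (x : Vec ℕ k) →
          close δ (d ∷ x) ≡ inst (substP δ (liftσ (λ i → nm (lookup x i)))) d
close-∷ δ d x = sym (substP-∘ δ λ { zero → refl ; (suc i) → refl })

Π-cong-⇔ : ∀ {A : Set} {P Q : A → Set} → (∀ a → P a ⇔ Q a) → (∀ a → P a) ⇔ (∀ a → Q a)
Π-cong-⇔ P⇔Q = mk⇔ (λ f a → to (P⇔Q a) (f a)) (λ f a → from (P⇔Q a) (f a))

module _ {k n} {σ : Fin k → Term n} {v : Vec ℕ n} {w : Vec ℕ k}
         (σ≗w : ∀ i → evalT (σ i) v ≡ lookup w i) where

  evalT-substT : ∀ t → evalT (substT σ t) v ≡ evalT t w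
  evalT-substT (var i) = σ≗w i
  evalT-substT (nm c)  = refl

  evalT-map-substT : ∀ {m} (ts : Vec (Term k) m) →
                     V.map (λ t → evalT t v) (V.map (substT σ) ts) ≡ V.map (λ t → evalT t w) ts
  evalT-map-substT ts = trans (sym (map-∘ _ (substT σ) ts)) (map-cong evalT-substT ts)

  liftσ-eval : ∀ d i → evalT (liftσ σ i) (d ∷ v) ≡ lookup (d ∷ w) i
  liftσ-eval d zero    = refl
  liftσ-eval d (suc i) = trans (evalT-wkT (σ i)) (σ≗w i)
    where
    evalT-wkT : ∀ t → evalT (wkT t) (d ∷ v) ≡ evalT t v
    evalT-wkT (var j) = refl
    evalT-wkT (nm c)  = refl

module _ {S} (M : Struct S) where

  Holds-substF : ∀ {k n} (φ : Fml S k) {σ : Fin k → Term n} {v : Vec ℕ n} {w : Vec ℕ k} →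
                 (∀ i → evalT (σ i) v ≡ lookup w i) →
                 ∀ s → Holds M (substF φ σ) v s ⇔ Holds M φ w s
  Holds-substF ⊤ᶠ e s = K-refl
  Holds-substF ⊥ᶠ e s = K-refl
  Holds-substF (t ≐ u) e s = K-reflexive (cong₂ _≡_ (evalT-substT e t) (evalT-substT e u))
  Holds-substF (flu F ts) e s = K-reflexive (cong (λ y → Flu M F y s) (evalT-map-substT e ts))
  Holds-substF (¬ᶠ φ) e s = ¬-cong-⇔ (Holds-substF φ e s)
  Holds-substF (φ ∧ᶠ ψ) e s = Holds-substF φ e s ×-⇔ Holds-substF ψ e s
  Holds-substF (φ ∨ᶠ ψ) e s = Holds-substF φ e s ⊎-⇔ Holds-substF ψ e s
  Holds-substF (φ ⇒ᶠ ψ) e s = →-cong-⇔ (Holds-substF φ e s) (Holds-substF ψ e s)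
  Holds-substF (∃ᶠ φ) e s = Σ-congˡ λ {d} → Holds-substF φ (liftσ-eval e d) s
  Holds-substF (∀ᶠ φ) e s = Π-cong-⇔ λ d → Holds-substF φ (liftσ-eval e d) s

module Transitions {S} (M : Struct S) where

  infix 4 _⊑_
  record _⊑_ (δ δ' : Prog S 0) : Set where
    field
      trans⊑ : ∀ {s γ s'} → Trans M δ s γ s' → Trans M δ' s γ s'
      final⊑ : ∀ {s} → Final M δ s → Final M δ' s
  open _⊑_

  ⊑-refl : ∀ {δ} → δ ⊑ δ
  ⊑-refl = record { trans⊑ = λ t → t ; final⊑ = λ f → f }

  ⊑-reflexive : ∀ {δ δ'} → δ ≡ δ' → δ ⊑ δ'
  ⊑-reflexive refl = ⊑-refl

  ⊑-trans : ∀ {δ δ' δ''} → δ ⊑ δ' → δ' ⊑ δ'' → δ ⊑ δ''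
  ⊑-trans p q = record { trans⊑ = λ t → trans⊑ q (trans⊑ p t) ; final⊑ = λ f → final⊑ q (final⊑ p f) }

  ⊑-∣ˡ : ∀ {δ γ} → δ ⊑ δ ∣ γ
  ⊑-∣ˡ = record { trans⊑ = t-ch₁ ; final⊑ = f-ch₁ }

  ⊑-∣ʳ : ∀ {δ γ} → γ ⊑ δ ∣ γ
  ⊑-∣ʳ = record { trans⊑ = t-ch₂ ; final⊑ = f-ch₂ }

  inst⊑pick : ∀ δ d → inst δ d ⊑ pick δ
  inst⊑pick δ d = record { trans⊑ = t-pick d ; final⊑ = f-pick d }

  ⊑-choiceFin : ∀ n (f : Fin n → Prog S 0) i → f i ⊑ choiceFin n f
  ⊑-choiceFin (suc zero)    f zero    = ⊑-refl
  ⊑-choiceFin (suc (suc n)) f zero    = ⊑-∣ˡ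
  ⊑-choiceFin (suc (suc n)) f (suc i) = ⊑-trans (⊑-choiceFin (suc n) (λ j → f (suc j)) i) ⊑-∣ʳ

  close⊑piAll : ∀ k (δ : Prog S k) x → close δ x ⊑ piAll k δ
  close⊑piAll zero    δ []      = ⊑-reflexive (close-[] δ)
  close⊑piAll (suc k) δ (d ∷ x) =
    ⊑-trans (⊑-reflexive (close-∷ δ d x)) (⊑-trans (inst⊑pick _ d) (close⊑piAll k (pick δ) x))

  Do-mono : ∀ {δ δ' s s'} → δ ⊑ δ' → Do M δ s s' → Do M δ' s s'
  Do-mono δ⊑δ' (_ , ε , f)      = _ , ε , final⊑ δ⊑δ' f
  Do-mono δ⊑δ' (_ , t ◅ ts , f) = _ , trans⊑ δ⊑δ' t ◅ ts , f

  _◅◅_ : ∀ {δ s δ' s' δ'' s''} → Trans* M δ s δ' s' → Trans* M δ' s' δ'' s'' →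
         Trans* M δ s δ'' s''
  ε        ◅◅ us = us
  (t ◅ ts) ◅◅ us = t ◅ (ts ◅◅ us)

  Trans*-⨾ : ∀ {δ s δ' s' γ} → Trans* M δ s δ' s' → Trans* M (δ ⨾ γ) s (δ' ⨾ γ) s'
  Trans*-⨾ ε        = ε
  Trans*-⨾ (t ◅ ts) = t-seq₁ t ◅ Trans*-⨾ ts

  -- Trans* grows at the front, so to extend a run of δ* at its end we keep a halted
  -- configuration that can still take every step δ* itself takes there.
  record Resumable (δ : Prog S 0) (s₀ s : Sit S) : Set where
    field
      conf    : Prog S 0
      run     : Trans* M (star δ) s₀ conf s
      halts   : Final M conf s
      resumes : ∀ {γ s'} → Trans M (star δ) s γ s' → Trans M conf s γ s'
  open Resumable

  Resumable-start : ∀ {δ s} → Resumable δ s s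
  Resumable-start = record { conf = star _ ; run = ε ; halts = f-star ; resumes = λ t → t }

  Resumable⇒Do : ∀ {δ s₀ s} → Resumable δ s₀ s → Do M (star δ) s₀ s
  Resumable⇒Do r = conf r , run r , halts r

  Resumable-step : ∀ {δ s₀ s s'} → Resumable δ s₀ s → Do M δ s s' → Resumable δ s₀ s'
  Resumable-step r (_ , ε , _) = r
  Resumable-step r (δ' , t ◅ ts , f) = record
    { conf    = δ' ⨾ star _
    ; run     = run r ◅◅ (resumes r (t-star t) ◅ Trans*-⨾ ts)
    ; halts   = f-seq f f-star
    ; resumes = t-seq₂ f
    }

module Refined {Sh Sl : Sig} {Dh : BAT Sh} {Dl : BAT Sl} (m : Refinement Dh Dl)
               (Mh : Struct Sh) (Ml : Struct Sl) where
  open Transitions Ml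
  open EquationalReasoning

  Holds-mapF : ∀ {sh sl} → MIso m Mh Ml sh sl → ∀ {n} (φ : Fml Sh n) v →
               Holds Mh φ v sh ⇔ Holds Ml (mapF m φ) v sl
  Holds-mapF iso ⊤ᶠ v = K-refl
  Holds-mapF iso ⊥ᶠ v = K-refl
  Holds-mapF iso (t ≐ u) v = K-refl
  Holds-mapF {sl = sl} iso (flu F ts) v =
    K-trans (iso F _) (SK-sym (Holds-substF Ml (mF m F) (λ i → sym (lookup-map i _ ts)) sl))
  Holds-mapF iso (¬ᶠ φ) v = ¬-cong-⇔ (Holds-mapF iso φ v)
  Holds-mapF iso (φ ∧ᶠ ψ) v = Holds-mapF iso φ v ×-⇔ Holds-mapF iso ψ v
  Holds-mapF iso (φ ∨ᶠ ψ) v = Holds-mapF iso φ v ⊎-⇔ Holds-mapF iso ψ v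
  Holds-mapF iso (φ ⇒ᶠ ψ) v = →-cong-⇔ (Holds-mapF iso φ v) (Holds-mapF iso ψ v)
  Holds-mapF iso (∃ᶠ φ) v = Σ-congˡ λ {d} → Holds-mapF iso φ (d ∷ v)
  Holds-mapF iso (∀ᶠ φ) v = Π-cong-⇔ λ d → Holds-mapF iso φ (d ∷ v)

  module _ (model : IsModel Dh Mh) {sh sl} (iso : MIso m Mh Ml sh sl)
           {A : Fin (nA Sh)} {x : Vec ℕ (arA Sh A)} where
    Poss⇔Do : (Holds Ml (mapF m (φPoss Dh A)) x sl ⇔ Σ (Sit Sl) (Do Ml (close (mA m A) x) sl)) →
              Poss Mh (A , x) sh ⇔ Σ (Sit Sl) (Do Ml (close (mA m A) x) sl)
    Poss⇔Do possˡ = begin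
      Poss Mh (A , x) sh                        ∼⟨ proj₁ (proj₂ model) A x sh ⟩
      Holds Mh (φPoss Dh A) x sh                ∼⟨ Holds-mapF iso (φPoss Dh A) x ⟩
      Holds Ml (mapF m (φPoss Dh A)) x sl       ∼⟨ possˡ ⟩
      Σ (Sit Sl) (Do Ml (close (mA m A) x) sl)  ∎

    MIso-do : ∀ {sl'} →
              (∀ F y → Holds Ml (mapF m (φssa Dh F A)) (y ++ x) sl ⇔ Holds Ml (mF m F) y sl') →
              MIso m Mh Ml (doₛ (A , x) sh) sl'
    MIso-do {sl'} ssaˡ F y = begin
      Flu Mh F y (doₛ (A , x) sh)                   ∼⟨ proj₂ (proj₂ model) F A y x sh ⟩
      Holds Mh (φssa Dh F A) (y ++ x) sh            ∼⟨ Holds-mapF iso (φssa Dh F A) (y ++ x) ⟩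
      Holds Ml (mapF m (φssa Dh F A)) (y ++ x) sl   ∼⟨ ssaˡ F y ⟩
      Holds Ml (mF m F) y sl'                       ∎

  close⊑any1hl : ∀ A x → close (mA m A) x ⊑ any1hl m
  close⊑any1hl A x = ⊑-trans (close⊑piAll _ (mA m A) x) (⊑-choiceFin (nA Sh) _ A)

  Reachable : Sit Sl → Set
  Reachable = Resumable (any1hl m) S₀

  Reachable-do : ∀ {A x s s'} → Reachable s → Do Ml (close (mA m A) x) s s' → Reachable s'
  Reachable-do {A} {x} r d = Resumable-step r (Do-mono (close⊑any1hl A x) d)

lemma4 : ∀ {Sh Sl : Sig} (Dh : BAT Sh) (Dl : BAT Sl) (m : Refinement Dh Dl)
           (Mh : Struct Sh) (Ml : Struct Sl) →
         IsModel Dh Mh → IsModel Dl Ml →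
         -- (a)
         MIso m Mh Ml S₀ S₀ →
         -- (b)
         (∀ (s : Sit Sl) → Do Ml (anyseqhl m) S₀ s →
            ∀ (A : Fin (nA Sh)) (x : Vec ℕ (arA Sh A)) →
            Holds Ml (mapF m (φPoss Dh A)) x s
              ⇔ Σ (Sit Sl) (λ s' → Do Ml (close (mA m A) x) s s')) →
         -- (c)
         (∀ (s : Sit Sl) → Do Ml (anyseqhl m) S₀ s →
            ∀ (A : Fin (nA Sh)) (x : Vec ℕ (arA Sh A)) (s' : Sit Sl) →
            Do Ml (close (mA m A) x) s s' →
            ∀ (F : Fin (nF Sh)) (y : Vec ℕ (arF Sh F)) →
            Holds Ml (mapF m (φssa Dh F A)) (y ++ x) s
              ⇔ Holds Ml (mF m F) y s') →
         Bisimilar m Mh Ml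
lemma4 {Sh} {Sl} Dh Dl m Mh Ml modelʰ _ init possˡ ssaˡ = B , isBisim , init , Resumable-start
  where
  open Transitions Ml
  open Refined m Mh Ml

  B : Sit Sh → Sit Sl → Set
  B sh sl = MIso m Mh Ml sh sl × Reachable sl

  isBisim : IsBisim m Mh Ml B
  isBisim sh sl (iso , reachable) = iso
    , (λ { A x _ p refl → let sl' , d = to (poss⇔do A x) p in sl' , d , B-do d })
    , (λ A x sl' d → doₛ (A , x) sh , (from (poss⇔do A x) (sl' , d) , refl) , B-do d)
    where
    run : Do Ml (anyseqhl m) S₀ sl
    run = Resumable⇒Do reachable

    poss⇔do : ∀ A x → Poss Mh (A , x) sh ⇔ Σ (Sit Sl) (Do Ml (close (mA m A) x) sl)
    poss⇔do A x = Poss⇔Do modelʰ iso (possˡ sl run A x)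

    B-do : ∀ {A x sl'} → Do Ml (close (mA m A) x) sl sl' → B (doₛ (A , x) sh) sl'
    B-do {A} {x} d = MIso-do modelʰ iso (ssaˡ sl run A x _ d) , Reachable-do {A} {x} reachable d
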